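{- For any odd $k\ge 2$ and any $n\ge k+4$, every binary $3$-$(n,k)$-design contains at least $14$ blocks.
   Context: Let $N$ be an $n$-element set of points. A binary $t$-$(n,k)$-design is a nonempty set $D$ of $k$-element subsets of $N$ (blocks; no repeated blocks) such that every $t$-element subset of $N$ is contained in an even number of blocks of $D$. -}

module Defs where

open import Data.Nat using (ℕ; _≤_; _+_)
open import Data.Nat.Divisibility using (_∣_)
open import Data.Fin.Subset using (Subset; ∣_∣; _⊆_)
open import Data.Fin.Subset.Properties using (_⊆?_)
open import Data.List using (List; length; filter; [])
open import Data.List.Relation.Unary.All using (All)
open import Data.List.Relation.Unary.Unique.Propositional using (Unique)
open import Relation.Binary.PropositionalEquality using (_≡_; _≢_)

occurrences : ∀ {n} → Subset n → List (Subset n) → ℕ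
occurrences T D = length (filter (T ⊆?_) D)

record BinaryDesign (t n k : ℕ) (D : List (Subset n)) : Set where
  field
    nonempty : D ≢ []
    distinct : Unique D
    blockSize : All (λ B → ∣ B ∣ ≡ k) D
    even : ∀ (T : Subset n) → ∣ T ∣ ≡ t → 2 ∣ occurrences T D

-- Deleting a point z splits a family F into the derived family (blocks through z, minus z)
-- and the residual family (blocks avoiding z). If every s-set and every (s+1)-set lies in an
-- even number of blocks of F, then so does every s-set in both parts. Splitting at a point
-- where both parts are nonempty gives by induction |F| ≥ 2^t if F is even on the levels
-- 0, …, t-1, and |F| ≥ 2^(t+1) - 1 if F is even on the levels 1, …, t.
--
-- A binary 3-design D with odd block size k is also even on level 2 (count the flags
-- (point, block)), and k ≠ 3 since a block contains itself; so k ≥ 5. If some point lies on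
-- every block, the derived family there is even on the levels 1, 2, 3, so |D| ≥ 15.
-- Otherwise a point of positive degree lies on at least 7 blocks and, by a smaller count of
-- the same kind, is avoided by at least 6; so if |D| ≤ 13 all degrees are 0 or 7 and D splits
-- as 7 + 6 at some point y. The degree a_w of a point w in the derived family at y is then
-- 0 or 4, while a_w + c_w, with c_w its degree in the residual family, is a degree of D.
-- Hence 7 a_w = 4 (a_w + c_w), and summing over w gives 49 (k - 1) = 4 (7 (k - 1) + 6 k).

module Submission where

open import Defs
open import Algebra.Bundles using (CommutativeMonoid)
open import Data.Bool using (true; false; not; _∨_; _∧_; if_then_else_)
open import Data.Bool.Properties using (_≟_; ∧-identityʳ; ∧-commutativeMonoid)
open import Algebra.Properties.CommutativeSemigroup
  (CommutativeMonoid.commutativeSemigroup ∧-commutativeMonoid) using (x∙yz≈y∙xz)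
open import Data.Empty using (⊥)
open import Data.Fin using (Fin; zero; suc)
open import Data.Fin.Properties using (any?; ¬∀⟶∃¬)
open import Data.Fin.Subset using (Subset; inside; outside; ⁅_⁆; ∣_∣; _⊆_) renaming (⊥ to ∅)
open import Data.Fin.Subset.Properties
  using (_⊆?_; ⊆-refl; ⊆-min; ∣⊥∣≡0; ∣⁅x⁆∣≡1; out⊆; in⊆in; drop-∷-⊆; p⊆q⇒∣p∣≤∣q∣)
open import Data.List using (List; []; _∷_; length)
open import Data.List.Properties using (filter-accept; filter-all; filter-none; length-filter)
open import Data.List.Relation.Unary.All as All using (All; []; _∷_)
open import Data.List.Relation.Unary.AllPairs as AllPairs using ([]; _∷_)
open import Data.List.Relation.Unary.Unique.Propositional using (Unique)
open import Data.Nat using (ℕ; zero; suc; 2+; _+_; _*_; _∸_; _^_; _≤_; _<_; z≤n; s≤s; _≤?_)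
open import Data.Nat.Divisibility
  using (_∣_; _∣?_; _∣0; divides; ∣-refl; n∣m*n; ∣m∣n⇒∣m+n; ∣m+n∣m⇒∣n; *-cancelˡ-∣)
open import Data.Nat.Primality using (euclidsLemma; prime[2])
open import Data.Nat.Properties
  using ( suc-injective; +-suc; +-identityʳ; *-identityʳ; *-zeroʳ; *-suc; ∸-+-assoc; m∸n+n≡m
        ; ≤-reflexive; ≤-trans; ≤-antisym; ≤-pred; <-irrefl; <⇒≱; ≮⇒≥; n≤1+n
        ; m<n⇒m<1+n; m<1+n⇒m≤n; m<m+n; m≢1+m+n; m+n≤o⇒n≤o
        ; +-mono-≤; +-monoʳ-≤; +-cancelˡ-≡; +-cancelˡ-≤; +-cancelʳ-≤; +-*-semiring
        ; module ≤-Reasoning)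
open import Data.Nat.Tactic.RingSolver using (solve-∀)
open import Algebra.Properties.Semiring.Sum +-*-semiring
  using (sum-syntax; ∑-distrib-+; *-distribˡ-sum; sum-cong-≗; sum-replicate-zero)
open import Data.Product using (∃; ∃₂; _×_; _,_)
open import Data.Sum using (_⊎_; inj₁; inj₂; [_,_]′)
open import Data.Vec using ([]; _∷_; insertAt; removeAt; lookup; here)
open import Data.Vec.Properties using (insertAt-removeAt; tabulate∘lookup; tabulate-cong)
open import Function using (id; flip)
open import Relation.Nullary using (¬_; Dec; yes; no; does; contradiction)
open import Relation.Nullary.Decidable using (dec-true; from-no)
open import Relation.Binary.PropositionalEquality

private variable
  n m k s : ℕ

⊆?-∷ : ∀ x y (p q : Subset n) → does (x ∷ p ⊆? y ∷ q) ≡ (not x ∨ y) ∧ does (p ⊆? q)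
⊆?-∷ outside y       p q = refl
⊆?-∷ inside  outside p q = refl
⊆?-∷ inside  inside  p q = refl

⊆?-insertAt : ∀ (p : Subset n) z x (q : Subset (suc n)) →
  does (insertAt p z x ⊆? q) ≡ does (x ∷ p ⊆? lookup q z ∷ removeAt q z)
⊆?-insertAt p       zero    x (y ∷ q)          = refl
⊆?-insertAt (b ∷ p) (suc z) x (y ∷ q@(_ ∷ _)) = begin
  does (b ∷ insertAt p z x ⊆? y ∷ q)
    ≡⟨ ⊆?-∷ b y _ q ⟩
  (not b ∨ y) ∧ does (insertAt p z x ⊆? q)
    ≡⟨ cong ((not b ∨ y) ∧_) (trans (⊆?-insertAt p z x q) (⊆?-∷ x _ p _)) ⟩
  (not b ∨ y) ∧ (not x ∨ lookup q z) ∧ does (p ⊆? removeAt q z)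
    ≡⟨ x∙yz≈y∙xz (not b ∨ y) (not x ∨ lookup q z) _ ⟩
  (not x ∨ lookup q z) ∧ (not b ∨ y) ∧ does (p ⊆? removeAt q z)
    ≡⟨ trans (⊆?-∷ x _ (b ∷ p) _) (cong ((not x ∨ lookup q z) ∧_) (⊆?-∷ b y p _)) ⟨
  does (x ∷ b ∷ p ⊆? lookup q z ∷ y ∷ removeAt q z)
    ∎
  where open ≡-Reasoning

∣insertAt∣ : ∀ (p : Subset n) z x → ∣ insertAt p z x ∣ ≡ ∣ x ∷ p ∣
∣insertAt∣ p             zero    x       = refl
∣insertAt∣ (outside ∷ p) (suc z) outside = ∣insertAt∣ p z outside
∣insertAt∣ (outside ∷ p) (suc z) inside  = ∣insertAt∣ p z inside
∣insertAt∣ (inside ∷ p)  (suc z) outside = cong suc (∣insertAt∣ p z outside)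
∣insertAt∣ (inside ∷ p)  (suc z) inside  = cong suc (∣insertAt∣ p z inside)

∣removeAt∣ : ∀ (q : Subset (suc n)) z {x} → lookup q z ≡ x → ∣ q ∣ ≡ ∣ x ∷ removeAt q z ∣
∣removeAt∣ q z refl =
  trans (cong ∣_∣ (sym (insertAt-removeAt q z))) (∣insertAt∣ (removeAt q z) z (lookup q z))

removeAt-injective : ∀ z (B C : Subset (suc n)) → lookup B z ≡ lookup C z →
  removeAt B z ≡ removeAt C z → B ≡ C
removeAt-injective z B C B[z]≡C[z] B-z≡C-z = begin
  B                                      ≡⟨ insertAt-removeAt B z ⟨
  insertAt (removeAt B z) z (lookup B z) ≡⟨ cong₂ (λ D x → insertAt D z x) B-z≡C-z B[z]≡C[z] ⟩
  insertAt (removeAt C z) z (lookup C z) ≡⟨ insertAt-removeAt C z ⟩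
  C                                      ∎
  where open ≡-Reasoning

lookup-≢ : ∀ {B C : Subset n} → B ≢ C → ∃ λ z → lookup B z ≢ lookup C z
lookup-≢ {n} {B} {C} B≢C = ¬∀⟶∃¬ n _ (λ z → lookup B z ≟ lookup C z) λ B≗C →
  B≢C (trans (sym (tabulate∘lookup B)) (trans (tabulate-cong B≗C) (tabulate∘lookup C)))

∣p∣≡0⇒p≡∅ : ∀ {p : Subset n} → ∣ p ∣ ≡ 0 → p ≡ ∅
∣p∣≡0⇒p≡∅ {p = []}          _ = refl
∣p∣≡0⇒p≡∅ {p = outside ∷ p} e = cong (outside ∷_) (∣p∣≡0⇒p≡∅ e)

∣p∣≡1+s⇒p≡insertAt : ∀ (p : Subset (suc n)) → ∣ p ∣ ≡ suc s →
  ∃₂ λ z q → p ≡ insertAt q z inside × ∣ q ∣ ≡ s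
∣p∣≡1+s⇒p≡insertAt         (inside ∷ p)   e = zero , p , refl , suc-injective e
∣p∣≡1+s⇒p≡insertAt {zero}  (outside ∷ []) ()
∣p∣≡1+s⇒p≡insertAt {suc n} (outside ∷ p)  e with ∣p∣≡1+s⇒p≡insertAt p e
... | z , q , refl , ∣q∣ = suc z , outside ∷ q , refl , ∣q∣

⁅⁆≡insertAt∅ : ∀ (z : Fin (suc n)) → ⁅ z ⁆ ≡ insertAt ∅ z inside
⁅⁆≡insertAt∅         zero    = refl
⁅⁆≡insertAt∅ {suc n} (suc z) = cong (outside ∷_) (⁅⁆≡insertAt∅ z)

∣p∣≡1⇒p≡⁅⁆ : ∀ (p : Subset n) → ∣ p ∣ ≡ 1 → ∃ λ z → p ≡ ⁅ z ⁆
∣p∣≡1⇒p≡⁅⁆ {zero}  [] ()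
∣p∣≡1⇒p≡⁅⁆ {suc n} p  e with ∣p∣≡1+s⇒p≡insertAt p e
... | z , q , refl , ∣q∣ =
  z , trans (cong (λ r → insertAt r z inside) (∣p∣≡0⇒p≡∅ ∣q∣)) (sym (⁅⁆≡insertAt∅ z))

⁅⁆⊆?≡lookup : ∀ (w : Fin n) B → does (⁅ w ⁆ ⊆? B) ≡ lookup B w
⁅⁆⊆?≡lookup {suc n} w B = begin
  does (⁅ w ⁆ ⊆? B)
    ≡⟨ cong (λ T → does (T ⊆? B)) (⁅⁆≡insertAt∅ w) ⟩
  does (insertAt ∅ w inside ⊆? B)
    ≡⟨ trans (⊆?-insertAt ∅ w inside B) (⊆?-∷ inside (lookup B w) ∅ _) ⟩
  lookup B w ∧ does (∅ ⊆? removeAt B w)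
    ≡⟨ cong (lookup B w ∧_) (dec-true (∅ ⊆? removeAt B w) (⊆-min _)) ⟩
  lookup B w ∧ true
    ≡⟨ ∧-identityʳ _ ⟩
  lookup B w
    ∎
  where open ≡-Reasoning

⊆-∃-∣∣≡ : ∀ (q : Subset n) → s ≤ ∣ q ∣ → ∃ λ p → p ⊆ q × ∣ p ∣ ≡ s
⊆-∃-∣∣≡ {n} {zero}  q             _         = ∅ , ⊆-min q , ∣⊥∣≡0 n
⊆-∃-∣∣≡ {s = suc s} (inside ∷ q)  (s≤s s≤∣q∣) with ⊆-∃-∣∣≡ q s≤∣q∣
... | p , p⊆q , ∣p∣ = inside ∷ p , in⊆in p⊆q , cong suc ∣p∣
⊆-∃-∣∣≡ {s = suc s} (outside ∷ q) s<∣q∣     with ⊆-∃-∣∣≡ q s<∣q∣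
... | p , p⊆q , ∣p∣ = outside ∷ p , out⊆ p⊆q , ∣p∣

⊆∧∣∣≡⇒≡ : ∀ {p q : Subset n} → p ⊆ q → ∣ p ∣ ≡ ∣ q ∣ → p ≡ q
⊆∧∣∣≡⇒≡ {p = []}          {[]}          _   _ = refl
⊆∧∣∣≡⇒≡ {p = inside ∷ p}  {inside ∷ q}  p⊆q e =
  cong (inside ∷_) (⊆∧∣∣≡⇒≡ (drop-∷-⊆ p⊆q) (suc-injective e))
⊆∧∣∣≡⇒≡ {p = inside ∷ p}  {outside ∷ q} p⊆q _ = contradiction (p⊆q here) λ ()
⊆∧∣∣≡⇒≡ {p = outside ∷ p} {outside ∷ q} p⊆q e = cong (outside ∷_) (⊆∧∣∣≡⇒≡ (drop-∷-⊆ p⊆q) e)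
⊆∧∣∣≡⇒≡ {p = outside ∷ p} {inside ∷ q}  p⊆q e =
  contradiction (subst (_≤ ∣ q ∣) e (p⊆q⇒∣p∣≤∣q∣ (drop-∷-⊆ p⊆q))) (<-irrefl refl)

-- Derived and residual families

Uniform : ℕ → List (Subset n) → Set
Uniform m F = All (λ B → ∣ B ∣ ≡ m) F

record UniformFamily (m : ℕ) (F : List (Subset n)) : Set where
  field
    distinct : Unique F
    uniform  : Uniform m F

EvenCover : ℕ → List (Subset n) → Set
EvenCover s F = ∀ T → ∣ T ∣ ≡ s → 2 ∣ occurrences T F

derived : Fin (suc n) → List (Subset (suc n)) → List (Subset n)
derived z []      = []
derived z (B ∷ F) = if lookup B z then removeAt B z ∷ derived z F else derived z F

residual : Fin (suc n) → List (Subset (suc n)) → List (Subset n)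
residual z []      = []
residual z (B ∷ F) = if lookup B z then residual z F else removeAt B z ∷ residual z F

degree : Fin (suc n) → List (Subset (suc n)) → ℕ
degree z F = length (derived z F)

≡[]? : ∀ {A : Set} (L : List A) → Dec (L ≡ [])
≡[]? []      = yes refl
≡[]? (_ ∷ _) = no λ ()

1≤length : ∀ {A : Set} {L : List A} → L ≢ [] → 1 ≤ length L
1≤length {L = []}    L≢[] = contradiction refl L≢[]
1≤length {L = _ ∷ _} _    = s≤s z≤n

length-derived+residual : ∀ z (F : List (Subset (suc n))) →
  length F ≡ length (derived z F) + length (residual z F)
length-derived+residual z []      = refl
length-derived+residual z (B ∷ F) with lookup B z
... | inside  = cong suc (length-derived+residual z F)
... | outside = trans (cong suc (length-derived+residual z F)) (sym (+-suc _ _))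

residual≡[]⇒degree≡length : ∀ z (F : List (Subset (suc n))) → residual z F ≡ [] →
  degree z F ≡ length F
residual≡[]⇒degree≡length z F R≡[] = begin
  length (derived z F)                         ≡⟨ +-identityʳ _ ⟨
  length (derived z F) + 0                     ≡⟨ cong (λ R → length (derived z F) + length R) R≡[] ⟨
  length (derived z F) + length (residual z F) ≡⟨ length-derived+residual z F ⟨
  length F                                     ∎
  where open ≡-Reasoning

residual≡[]⇒derived≢[] : ∀ z (F : List (Subset (suc n))) → F ≢ [] → residual z F ≡ [] →
  derived z F ≢ []
residual≡[]⇒derived≢[] z []      F≢[] _    = contradiction refl F≢[]
residual≡[]⇒derived≢[] z (B ∷ F) _    R≡[] with lookup B z
... | inside  = λ ()
... | outside = contradiction R≡[] λ ()

module _ (z : Fin (suc n)) where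

  derived-distinct : ∀ {F} → Unique F → Unique (derived z F)
  derived-distinct {[]}    []          = []
  derived-distinct {B ∷ F} (B∉F ∷ F!) with lookup B z in B[z]
  ... | inside  = fresh F B∉F ∷ derived-distinct F!
    where
    fresh : ∀ F → All (B ≢_) F → All (removeAt B z ≢_) (derived z F)
    fresh []      []          = []
    fresh (C ∷ F) (B≢C ∷ B∉F) with lookup C z in C[z]
    ... | inside  = (λ eq → B≢C (removeAt-injective z B C (trans B[z] (sym C[z])) eq)) ∷ fresh F B∉F
    ... | outside = fresh F B∉F
  ... | outside = derived-distinct F!

  residual-distinct : ∀ {F} → Unique F → Unique (residual z F)
  residual-distinct {[]}    []          = []
  residual-distinct {B ∷ F} (B∉F ∷ F!) with lookup B z in B[z]
  ... | inside  = residual-distinct F!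
  ... | outside = fresh F B∉F ∷ residual-distinct F!
    where
    fresh : ∀ F → All (B ≢_) F → All (removeAt B z ≢_) (residual z F)
    fresh []      []          = []
    fresh (C ∷ F) (B≢C ∷ B∉F) with lookup C z in C[z]
    ... | inside  = fresh F B∉F
    ... | outside = (λ eq → B≢C (removeAt-injective z B C (trans B[z] (sym C[z])) eq)) ∷ fresh F B∉F

  derived-uniform : ∀ {F} → Uniform m F → Uniform (m ∸ 1) (derived z F)
  derived-uniform {F = []}    []          = []
  derived-uniform {F = B ∷ F} (∣B∣ ∷ ∣F∣) with lookup B z in B[z]
  ... | inside  = cong (_∸ 1) (trans (sym (∣removeAt∣ B z B[z])) ∣B∣) ∷ derived-uniform ∣F∣
  ... | outside = derived-uniform ∣F∣

  residual-uniform : ∀ {F} → Uniform m F → Uniform m (residual z F)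
  residual-uniform {F = []}    []          = []
  residual-uniform {F = B ∷ F} (∣B∣ ∷ ∣F∣) with lookup B z in B[z]
  ... | inside  = residual-uniform ∣F∣
  ... | outside = trans (sym (∣removeAt∣ B z B[z])) ∣B∣ ∷ residual-uniform ∣F∣

  derived-family : ∀ {F} → UniformFamily m F → UniformFamily (m ∸ 1) (derived z F)
  derived-family family = record
    { distinct = derived-distinct (UniformFamily.distinct family)
    ; uniform  = derived-uniform  (UniformFamily.uniform family)
    }

  residual-family : ∀ {F} → UniformFamily m F → UniformFamily m (residual z F)
  residual-family family = record
    { distinct = residual-distinct (UniformFamily.distinct family)
    ; uniform  = residual-uniform  (UniformFamily.uniform family)
    }

occurrences≤length : ∀ (T : Subset n) F → occurrences T F ≤ length F
occurrences≤length T F = length-filter (T ⊆?_) F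

occurrences-∅ : ∀ (F : List (Subset n)) → occurrences ∅ F ≡ length F
occurrences-∅ F = cong length (filter-all (∅ ⊆?_) (All.universal ⊆-min F))

occurrences-derived : ∀ (T : Subset n) z F →
  occurrences (insertAt T z inside) F ≡ occurrences T (derived z F)
occurrences-derived T z []      = refl
occurrences-derived T z (B ∷ F) rewrite ⊆?-insertAt T z inside B with lookup B z
... | outside = occurrences-derived T z F
... | inside with does (T ⊆? removeAt B z)
...   | true  = cong suc (occurrences-derived T z F)
...   | false = occurrences-derived T z F

occurrences-residual : ∀ (T : Subset n) z F →
  occurrences (insertAt T z outside) F ≡ occurrences T (derived z F) + occurrences T (residual z F)
occurrences-residual T z []      = refl
occurrences-residual T z (B ∷ F) rewrite ⊆?-insertAt T z outside B with lookup B z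
... | inside with does (T ⊆? removeAt B z)
...   | true  = cong suc (occurrences-residual T z F)
...   | false = occurrences-residual T z F
occurrences-residual T z (B ∷ F) | outside with does (T ⊆? removeAt B z)
...   | true  = trans (cong suc (occurrences-residual T z F)) (sym (+-suc _ _))
...   | false = occurrences-residual T z F

occurrences-⁅⁆ : ∀ z (F : List (Subset (suc n))) → occurrences ⁅ z ⁆ F ≡ degree z F
occurrences-⁅⁆ z F = begin
  occurrences ⁅ z ⁆ F                 ≡⟨ cong (λ T → occurrences T F) (⁅⁆≡insertAt∅ z) ⟩
  occurrences (insertAt ∅ z inside) F ≡⟨ occurrences-derived ∅ z F ⟩
  occurrences ∅ (derived z F)         ≡⟨ occurrences-∅ (derived z F) ⟩
  length (derived z F)                ∎
  where open ≡-Reasoning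

degree-derived+residual : ∀ {P : ℕ → Set} y w (F : List (Subset (suc n))) →
  (∀ x → P (degree x F)) → P (occurrences ⁅ w ⁆ (derived y F) + occurrences ⁅ w ⁆ (residual y F))
degree-derived+residual {P = P} y w F P-degree
  with ∣p∣≡1⇒p≡⁅⁆ (insertAt ⁅ w ⁆ y outside) (trans (∣insertAt∣ ⁅ w ⁆ y outside) (∣⁅x⁆∣≡1 w))
... | x , ⁅w⁆≡⁅x⁆ = subst P (sym occurrences≡) (P-degree x)
  where
  open ≡-Reasoning
  occurrences≡ : occurrences ⁅ w ⁆ (derived y F) + occurrences ⁅ w ⁆ (residual y F) ≡ degree x F
  occurrences≡ = begin
    occurrences ⁅ w ⁆ (derived y F) + occurrences ⁅ w ⁆ (residual y F)
      ≡⟨ occurrences-residual ⁅ w ⁆ y F ⟨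
    occurrences (insertAt ⁅ w ⁆ y outside) F
      ≡⟨ cong (λ T → occurrences T F) ⁅w⁆≡⁅x⁆ ⟩
    occurrences ⁅ x ⁆ F
      ≡⟨ occurrences-⁅⁆ x F ⟩
    degree x F
      ∎

∣-∑ : ∀ {d} (f : Fin n → ℕ) → (∀ w → d ∣ f w) → d ∣ ∑[ w < n ] f w
∣-∑ {zero}  f d∣f = _ ∣0
∣-∑ {suc n} f d∣f = ∣m∣n⇒∣m+n (d∣f zero) (∣-∑ (λ w → f (suc w)) (λ w → d∣f (suc w)))

∑-indicator : ∀ (B : Subset n) → ∑[ w < n ] (if lookup B w then 1 else 0) ≡ ∣ B ∣
∑-indicator []            = refl
∑-indicator (inside ∷ B)  = cong suc (∑-indicator B)
∑-indicator (outside ∷ B) = ∑-indicator B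

occurrences-⁅⁆-∷ : ∀ (w : Fin n) B F →
  occurrences ⁅ w ⁆ (B ∷ F) ≡ (if lookup B w then 1 else 0) + occurrences ⁅ w ⁆ F
occurrences-⁅⁆-∷ w B F rewrite ⁅⁆⊆?≡lookup w B with lookup B w
... | inside  = refl
... | outside = refl

∑-occurrences-⁅⁆ : ∀ {F : List (Subset n)} → Uniform m F →
  ∑[ w < n ] occurrences ⁅ w ⁆ F ≡ m * length F
∑-occurrences-⁅⁆ {n} {m} {[]}    []          = trans (sum-replicate-zero n) (sym (*-zeroʳ m))
∑-occurrences-⁅⁆ {n} {m} {B ∷ F} (∣B∣ ∷ ∣F∣) = begin
  ∑[ w < n ] occurrences ⁅ w ⁆ (B ∷ F)
    ≡⟨ sum-cong-≗ (λ w → occurrences-⁅⁆-∷ w B F) ⟩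
  ∑[ w < n ] ((if lookup B w then 1 else 0) + occurrences ⁅ w ⁆ F)
    ≡⟨ ∑-distrib-+ (λ w → if lookup B w then 1 else 0) _ ⟩
  ∑[ w < n ] (if lookup B w then 1 else 0) + ∑[ w < n ] occurrences ⁅ w ⁆ F
    ≡⟨ cong₂ _+_ (trans (∑-indicator B) ∣B∣) (∑-occurrences-⁅⁆ ∣F∣) ⟩
  m + m * length F
    ≡⟨ *-suc m (length F) ⟨
  m * length (B ∷ F)
    ∎
  where open ≡-Reasoning

derived-evenCover : ∀ z (F : List (Subset (suc n))) → EvenCover (suc s) F → EvenCover s (derived z F)
derived-evenCover z F even T ∣T∣ =
  subst (2 ∣_) (occurrences-derived T z F) (even _ (trans (∣insertAt∣ T z inside) (cong suc ∣T∣)))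

residual-evenCover : ∀ z (F : List (Subset (suc n))) →
  EvenCover s F → EvenCover (suc s) F → EvenCover s (residual z F)
residual-evenCover z F even even′ T ∣T∣ = ∣m+n∣m⇒∣n
  (subst (2 ∣_) (occurrences-residual T z F) (even _ (trans (∣insertAt∣ T z outside) ∣T∣)))
  (derived-evenCover z F even′ T ∣T∣)

residual≡[]⇒derived-evenCover : ∀ z (F : List (Subset (suc n))) → residual z F ≡ [] →
  EvenCover s F → EvenCover s (derived z F)
residual≡[]⇒derived-evenCover z F R≡[] even T ∣T∣ =
  subst (2 ∣_) occurrences≡ (even _ (trans (∣insertAt∣ T z outside) ∣T∣))
  where
  occurrences≡ : occurrences (insertAt T z outside) F ≡ occurrences T (derived z F)
  occurrences≡ = trans (occurrences-residual T z F)
    (trans (cong (λ R → occurrences T (derived z F) + occurrences T R) R≡[]) (+-identityʳ _))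

evenCover-lower : ∀ {F : List (Subset n)} → Uniform m F → ¬ 2 ∣ m ∸ s →
  EvenCover (suc s) F → EvenCover s F
evenCover-lower {n} {m} {zero} {F} ∣F∣ m-odd even T ∣T∣ =
  subst (λ T → 2 ∣ occurrences T F) (sym (∣p∣≡0⇒p≡∅ ∣T∣))
    (subst (2 ∣_) (sym (occurrences-∅ F)) 2∣∣F∣)
  where
  2∣m*∣F∣ : 2 ∣ m * length F
  2∣m*∣F∣ = subst (2 ∣_) (∑-occurrences-⁅⁆ ∣F∣) (∣-∑ _ (λ w → even ⁅ w ⁆ (∣⁅x⁆∣≡1 w)))
  2∣∣F∣ : 2 ∣ length F
  2∣∣F∣ = [ flip contradiction m-odd , id ]′ (euclidsLemma m (length F) prime[2] 2∣m*∣F∣)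
evenCover-lower {zero}  {s = suc s} _ _ _ [] ()
evenCover-lower {suc n} {m} {suc s} {F} ∣F∣ m-odd even T ∣T∣ with ∣p∣≡1+s⇒p≡insertAt T ∣T∣
... | z , S , refl , ∣S∣ = subst (2 ∣_) (sym (occurrences-derived S z F))
  (evenCover-lower (derived-uniform z ∣F∣) m∸1-odd (derived-evenCover z F even) S ∣S∣)
  where
  m∸1-odd : ¬ 2 ∣ m ∸ 1 ∸ s
  m∸1-odd 2∣ = m-odd (subst (2 ∣_) (∸-+-assoc m 1 s) 2∣)

-- Lower bounds

2≤length : ∀ {F : List (Subset n)} → F ≢ [] → Uniform m F → EvenCover s F → s ≤ m → 2 ≤ length F
2≤length {F = []}        F≢[] _ _ _ = contradiction refl F≢[]
2≤length {F = _ ∷ _ ∷ _} _    _ _ _ = s≤s (s≤s z≤n)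
2≤length {s = s} {F = B ∷ []} _ (∣B∣ ∷ []) even s≤m
  with ⊆-∃-∣∣≡ B (subst (s ≤_) (sym ∣B∣) s≤m)
... | T , T⊆B , ∣T∣ = contradiction
  (subst (2 ∣_) (cong length (filter-accept (T ⊆?_) T⊆B)) (even T ∣T∣)) (from-no (2 ∣? 1))

length<2-on-Subset0 : ∀ {F : List (Subset 0)} → Unique F → length F < 2
length<2-on-Subset0 {[]}          _               = s≤s z≤n
length<2-on-Subset0 {_ ∷ []}      _               = s≤s (s≤s z≤n)
length<2-on-Subset0 {[] ∷ [] ∷ _} ((B≢C ∷ _) ∷ _) = contradiction refl B≢C

splitting-point : ∀ {F : List (Subset (suc n))} → Unique F → 2 ≤ length F →
  ∃ λ z → derived z F ≢ [] × residual z F ≢ []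
splitting-point {F = _ ∷ []}    _               (s≤s ())
splitting-point {F = B ∷ C ∷ F} ((B≢C ∷ _) ∷ _) _ with lookup-≢ B≢C
... | z , B[z]≢C[z] = z , separates B[z]≢C[z]
  where
  separates : lookup B z ≢ lookup C z →
    derived z (B ∷ C ∷ F) ≢ [] × residual z (B ∷ C ∷ F) ≢ []
  separates B[z]≢C[z] with lookup B z | lookup C z
  ... | inside  | inside  = contradiction refl B[z]≢C[z]
  ... | inside  | outside = (λ ()) , (λ ())
  ... | outside | inside  = (λ ()) , (λ ())
  ... | outside | outside = contradiction refl B[z]≢C[z]

2^t≤length : ∀ t {F : List (Subset n)} → F ≢ [] → UniformFamily m F →
  (∀ {s} → s < t → EvenCover s F) → 2 ^ t ≤ length F
2^t≤length zero F≢[] _ _ = 1≤length F≢[]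
2^t≤length {zero} (suc t) F≢[] family even =
  contradiction (2≤length F≢[] (UniformFamily.uniform family) (even (s≤s z≤n)) z≤n)
    (<⇒≱ (length<2-on-Subset0 (UniformFamily.distinct family)))
2^t≤length {suc n} (suc t) {F} F≢[] family even
  with splitting-point (UniformFamily.distinct family)
         (2≤length F≢[] (UniformFamily.uniform family) (even (s≤s z≤n)) z≤n)
... | z , D≢[] , R≢[] = begin
  2 ^ t + (2 ^ t + 0)                          ≡⟨ cong (2 ^ t +_) (+-identityʳ _) ⟩
  2 ^ t + 2 ^ t                                ≤⟨ +-mono-≤ D-bound R-bound ⟩
  length (derived z F) + length (residual z F) ≡⟨ length-derived+residual z F ⟨
  length F                                     ∎
  where
  open ≤-Reasoning
  D-bound : 2 ^ t ≤ length (derived z F)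
  D-bound = 2^t≤length t D≢[] (derived-family z family) λ s<t → derived-evenCover z F (even (s≤s s<t))
  R-bound : 2 ^ t ≤ length (residual z F)
  R-bound = 2^t≤length t R≢[] (residual-family z family) λ s<t →
    residual-evenCover z F (even (m<n⇒m<1+n s<t)) (even (s≤s s<t))

2^1+t≤1+length : ∀ t {F : List (Subset n)} → 1 ≤ m → F ≢ [] → UniformFamily m F →
  (∀ {s} → s < t → EvenCover (suc s) F) → 2 ^ suc t ≤ suc (length F)
2^1+t≤1+length zero _ F≢[] _ _ = s≤s (1≤length F≢[])
2^1+t≤1+length {zero} (suc t) 1≤m F≢[] family even =
  contradiction (2≤length F≢[] (UniformFamily.uniform family) (even (s≤s z≤n)) 1≤m)
    (<⇒≱ (length<2-on-Subset0 (UniformFamily.distinct family)))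
2^1+t≤1+length {suc n} (suc t) {F} 1≤m F≢[] family even
  with splitting-point (UniformFamily.distinct family)
         (2≤length F≢[] (UniformFamily.uniform family) (even (s≤s z≤n)) 1≤m)
... | z , D≢[] , R≢[] = begin
  2 ^ suc t + (2 ^ suc t + 0)                        ≡⟨ cong (2 ^ suc t +_) (+-identityʳ _) ⟩
  2 ^ suc t + 2 ^ suc t                              ≤⟨ +-mono-≤ D-bound R-bound ⟩
  length (derived z F) + suc (length (residual z F)) ≡⟨ +-suc _ _ ⟩
  suc (length (derived z F) + length (residual z F)) ≡⟨ cong suc (length-derived+residual z F) ⟨
  suc (length F)                                     ∎
  where
  open ≤-Reasoning
  D-bound : 2 ^ suc t ≤ length (derived z F)
  D-bound = 2^t≤length (suc t) D≢[] (derived-family z family) λ s<1+t →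
    derived-evenCover z F (even s<1+t)
  R-bound : 2 ^ suc t ≤ suc (length (residual z F))
  R-bound = 2^1+t≤1+length t 1≤m R≢[] (residual-family z family) λ s<t →
    residual-evenCover z F (even (m<n⇒m<1+n s<t)) (even (s≤s s<t))

¬evenCover-blockSize : ∀ {F : List (Subset n)} → F ≢ [] → UniformFamily m F → ¬ EvenCover m F
¬evenCover-blockSize {F = []} F≢[] _ _ = F≢[] refl
¬evenCover-blockSize {m = m} {F = B ∷ F} _ family even =
  from-no (2 ∣? 1) (subst (2 ∣_) occurrences-B (even B ∣B∣))
  where
  open UniformFamily family
  ∣B∣ : ∣ B ∣ ≡ m
  ∣B∣ = All.head uniform
  B⊈ : ∀ {C} → B ≢ C × ∣ C ∣ ≡ m → ¬ B ⊆ C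
  B⊈ (B≢C , ∣C∣) B⊆C = B≢C (⊆∧∣∣≡⇒≡ B⊆C (trans ∣B∣ (sym ∣C∣)))
  occurrences-B : occurrences B (B ∷ F) ≡ 1
  occurrences-B = cong length (trans (filter-accept (B ⊆?_) ⊆-refl)
    (cong (B ∷_) (filter-none (B ⊆?_) (All.zipWith B⊈ (AllPairs.head distinct , All.tail uniform)))))

degree∈04 : ∀ {F : List (Subset (suc n))} → UniformFamily m F → 1 ≤ m →
  EvenCover 1 F → EvenCover 2 F → length F ≡ 7 → ∀ w → degree w F ≡ 0 ⊎ degree w F ≡ 4
degree∈04 {n} {F = F} family 1≤m even₁ even₂ ∣F∣≡7 w with ≡[]? (derived w F)
... | yes W≡[] = inj₁ (cong length W≡[])
... | no  W≢[] = inj₂ (≤-antisym ∣W∣≤4 4≤∣W∣)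
  where
  W V : List (Subset n)
  W = derived w F
  V = residual w F
  2∣∣W∣ : 2 ∣ length W
  2∣∣W∣ = subst (2 ∣_) (occurrences-⁅⁆ w F) (even₁ ⁅ w ⁆ (∣⁅x⁆∣≡1 w))
  4≤∣W∣ : 4 ≤ length W
  4≤∣W∣ = 2^t≤length 2 W≢[] (derived-family w family) levels
    where
    levels : ∀ {s} → s < 2 → EvenCover s W
    levels {0}    _ = derived-evenCover w F even₁
    levels {1}    _ = derived-evenCover w F even₂
    levels {2+ _} (s≤s (s≤s ()))
  V≢[] : V ≢ []
  V≢[] V≡[] =
    from-no (2 ∣? 7) (subst (2 ∣_) (trans (residual≡[]⇒degree≡length w F V≡[]) ∣F∣≡7) 2∣∣W∣)
  3≤∣V∣ : 3 ≤ length V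
  3≤∣V∣ = ≤-pred (2^1+t≤1+length 1 1≤m V≢[] (residual-family w family)
    λ { {zero} _ → residual-evenCover w F even₁ even₂ ; {suc _} (s≤s ()) })
  ∣W∣≤4 : length W ≤ 4
  ∣W∣≤4 = +-cancelʳ-≤ 3 (length W) 4 (≤-trans (+-monoʳ-≤ (length W) 3≤∣V∣)
    (≤-reflexive (trans (sym (length-derived+residual w F)) ∣F∣≡7)))

3≤d<5⇒d≡3⊎d≡4 : ∀ {d} → 3 ≤ d → d < 5 → d ≡ 3 ⊎ d ≡ 4
3≤d<5⇒d≡3⊎d≡4 (s≤s (s≤s (s≤s {n = 0} _)))           _ = inj₁ refl
3≤d<5⇒d≡3⊎d≡4 (s≤s (s≤s (s≤s {n = 1} _)))           _ = inj₂ refl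
3≤d<5⇒d≡3⊎d≡4 (s≤s (s≤s (s≤s {n = suc (suc _)} _))) (s≤s (s≤s (s≤s (s≤s (s≤s ())))))

5≤k⇒1≤k∸1 : 5 ≤ k → 1 ≤ k ∸ 1
5≤k⇒1≤k∸1 (s≤s (s≤s _)) = s≤s z≤n

odd⇒5≤k : ∀ k → ¬ 2 ∣ k → 2 ≤ k → k ≢ 3 → 5 ≤ k
odd⇒5≤k 1 _     (s≤s ()) _
odd⇒5≤k 2 k-odd _ _   = contradiction (divides 1 refl) k-odd
odd⇒5≤k 3 _     _ k≢3 = contradiction refl k≢3
odd⇒5≤k 4 k-odd _ _   = contradiction (divides 2 refl) k-odd
odd⇒5≤k (suc (suc (suc (suc (suc _))))) _ _ _ = s≤s (s≤s (s≤s (s≤s (s≤s z≤n))))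

odd⇒odd∸2 : ∀ k → 2 ≤ k → ¬ 2 ∣ k → ¬ 2 ∣ k ∸ 2
odd⇒odd∸2 k 2≤k k-odd 2∣k∸2 = k-odd (subst (2 ∣_) (m∸n+n≡m 2≤k) (∣m∣n⇒∣m+n 2∣k∸2 ∣-refl))

4∣a+2c : ∀ a c → 2 ∣ a → c ≤ 1 → a + c ≡ 0 ⊎ a + c ≡ 3 ⊎ a + c ≡ 4 → 4 ∣ a + 2 * c
4∣a+2c 0 0 _   _ _ = divides 0 refl
4∣a+2c 2 1 _   _ _ = divides 1 refl
4∣a+2c 4 0 _   _ _ = divides 1 refl
4∣a+2c 1 _ 2∣a _ _ = contradiction 2∣a (from-no (2 ∣? 1))
4∣a+2c 3 _ 2∣a _ _ = contradiction 2∣a (from-no (2 ∣? 3))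
4∣a+2c 0 1 _ _ (inj₂ (inj₁ ()))
4∣a+2c 0 1 _ _ (inj₂ (inj₂ ()))
4∣a+2c 2 0 _ _ (inj₂ (inj₁ ()))
4∣a+2c 2 0 _ _ (inj₂ (inj₂ ()))
4∣a+2c 4 1 _ _ (inj₂ (inj₂ ()))
4∣a+2c (suc (suc (suc (suc (suc a))))) c _ _ (inj₂ (inj₂ ()))
4∣a+2c _ (suc (suc _)) _ (s≤s ()) _

a≡2c : ∀ a c → 2 ∣ a → a ≤ 3 → c ≤ 2 → a + c ≡ 0 ⊎ a + c ≡ 3 → a ≡ 2 * c
a≡2c 0 0 _   _ _ _ = refl
a≡2c 2 1 _   _ _ _ = refl
a≡2c 1 _ 2∣a _ _ _ = contradiction 2∣a (from-no (2 ∣? 1))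
a≡2c 3 _ 2∣a _ _ _ = contradiction 2∣a (from-no (2 ∣? 3))
a≡2c 0 1 _ _ _ (inj₂ ())
a≡2c 0 2 _ _ _ (inj₂ ())
a≡2c 2 0 _ _ _ (inj₂ ())
a≡2c 2 2 _ _ _ (inj₂ ())
a≡2c (suc (suc (suc (suc _)))) _ _ (s≤s (s≤s (s≤s ()))) _ _
a≡2c _ (suc (suc (suc _))) _ _ (s≤s (s≤s ())) _

7a≡4[a+c] : ∀ a c → a ≡ 0 ⊎ a ≡ 4 → c ≤ 6 → a + c ≡ 0 ⊎ a + c ≡ 7 → 7 * a ≡ 4 * (a + c)
7a≡4[a+c] _ _ (inj₁ refl) _   (inj₁ refl) = refl
7a≡4[a+c] _ _ (inj₁ refl) c≤6 (inj₂ refl) = contradiction c≤6 (from-no (7 ≤? 6))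
7a≡4[a+c] _ _ (inj₂ refl) _   (inj₁ ())
7a≡4[a+c] _ _ (inj₂ refl) _   (inj₂ refl) = refl

4∣4[k-1]+2k⇒2∣k : ∀ k → 4 ∣ (k ∸ 1) * 4 + 2 * (k * 1) → 2 ∣ k
4∣4[k-1]+2k⇒2∣k k 4∣ =
  subst (2 ∣_) (*-identityʳ k) (*-cancelˡ-∣ 2 (∣m+n∣m⇒∣n 4∣ (n∣m*n (k ∸ 1))))

3[k-1]≢2kr : ∀ k r → 5 ≤ k → 1 ≤ r → r ≤ 2 → (k ∸ 1) * 3 ≢ 2 * (k * r)
3[k-1]≢2kr _ 1 (s≤s (s≤s (s≤s (s≤s (s≤s {n = j} _))))) _ _ eq =
  m≢1+m+n _ (trans (sym eq) (identity j))
  where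
  identity : ∀ j → (4 + j) * 3 ≡ suc (2 * ((5 + j) * 1) + suc j)
  identity = solve-∀
3[k-1]≢2kr _ 2 (s≤s (s≤s (s≤s (s≤s (s≤s {n = j} _))))) _ _ eq =
  m≢1+m+n _ (trans eq (identity j))
  where
  identity : ∀ j → 2 * ((5 + j) * 2) ≡ suc ((4 + j) * 3 + (7 + j))
  identity = solve-∀
3[k-1]≢2kr _ (suc (suc (suc _))) _ _ (s≤s (s≤s ()))

49[k-1]≢4[7[k-1]+6k] : ∀ k → 5 ≤ k → 7 * ((k ∸ 1) * 7) ≢ 4 * ((k ∸ 1) * 7 + k * 6)
49[k-1]≢4[7[k-1]+6k] _ (s≤s (s≤s (s≤s (s≤s (s≤s {n = j} _))))) eq =
  m≢1+m+n _ (trans eq (identity j))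
  where
  identity : ∀ j → 4 * ((4 + j) * 7 + (5 + j) * 6) ≡ suc (7 * ((4 + j) * 7) + (35 + j * 3))
  identity = solve-∀

-- Binary designs with odd block size

module _ {F : List (Subset (suc n))} (F≢[] : F ≢ []) (family : UniformFamily k F)
         (5≤k : 5 ≤ k) (k-odd : ¬ 2 ∣ k) (even₂ : EvenCover 2 F) where

  private
    open UniformFamily family

    1≤k∸1 : 1 ≤ k ∸ 1
    1≤k∸1 = 5≤k⇒1≤k∸1 5≤k

    3≤degree : ∀ x → derived x F ≢ [] → 3 ≤ degree x F
    3≤degree x D≢[] = ≤-pred (2^1+t≤1+length 1 1≤k∸1 D≢[] (derived-family x family)
      λ { {zero} _ → derived-evenCover x F even₂ ; {suc _} (s≤s ()) })

    module _ (avoided : ∀ z → residual z F ≢ []) (∣F∣≤5 : length F ≤ 5) where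

      degree<length : ∀ x → degree x F < length F
      degree<length x =
        subst (degree x F <_) (sym (length-derived+residual x F)) (m<m+n _ (1≤length (avoided x)))

      degree∈034 : ∀ x → degree x F ≡ 0 ⊎ degree x F ≡ 3 ⊎ degree x F ≡ 4
      degree∈034 x with ≡[]? (derived x F)
      ... | yes D≡[] = inj₁ (cong length D≡[])
      ... | no  D≢[] = inj₂ (3≤d<5⇒d≡3⊎d≡4 (3≤degree x D≢[]) (≤-trans (degree<length x) ∣F∣≤5))

      degree≢4 : ∀ y → degree y F ≢ 4
      degree≢4 y ∣D∣≡4 = k-odd (4∣4[k-1]+2k⇒2∣k k (subst (4 ∣_) ∑≡ (∣-∑ _ pointwise)))
        where
        D R : List (Subset n)
        D = derived y F
        R = residual y F
        ∣F∣≡5 : length F ≡ 5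
        ∣F∣≡5 = ≤-antisym ∣F∣≤5 (subst (_< length F) ∣D∣≡4 (degree<length y))
        ∣R∣≡1 : length R ≡ 1
        ∣R∣≡1 = +-cancelˡ-≡ 4 _ _
          (trans (cong (_+ length R) (sym ∣D∣≡4)) (trans (sym (length-derived+residual y F)) ∣F∣≡5))
        pointwise : ∀ w → 4 ∣ occurrences ⁅ w ⁆ D + 2 * occurrences ⁅ w ⁆ R
        pointwise w = 4∣a+2c _ _ (derived-evenCover y F even₂ ⁅ w ⁆ (∣⁅x⁆∣≡1 w))
          (subst (occurrences ⁅ w ⁆ R ≤_) ∣R∣≡1 (occurrences≤length ⁅ w ⁆ R))
          (degree-derived+residual {P = λ d → d ≡ 0 ⊎ d ≡ 3 ⊎ d ≡ 4} y w F degree∈034)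
        ∑≡ : ∑[ w < n ] (occurrences ⁅ w ⁆ D + 2 * occurrences ⁅ w ⁆ R) ≡ (k ∸ 1) * 4 + 2 * (k * 1)
        ∑≡ = begin
          ∑[ w < n ] (occurrences ⁅ w ⁆ D + 2 * occurrences ⁅ w ⁆ R)
            ≡⟨ ∑-distrib-+ (λ w → occurrences ⁅ w ⁆ D) _ ⟩
          ∑[ w < n ] occurrences ⁅ w ⁆ D + ∑[ w < n ] (2 * occurrences ⁅ w ⁆ R)
            ≡⟨ cong (∑[ w < n ] occurrences ⁅ w ⁆ D +_) (*-distribˡ-sum 2 (λ w → occurrences ⁅ w ⁆ R)) ⟨
          ∑[ w < n ] occurrences ⁅ w ⁆ D + 2 * ∑[ w < n ] occurrences ⁅ w ⁆ R
            ≡⟨ cong₂ (λ a c → a + 2 * c) (∑-occurrences-⁅⁆ (derived-uniform y uniform))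
                                         (∑-occurrences-⁅⁆ (residual-uniform y uniform)) ⟩
          (k ∸ 1) * length D + 2 * (k * length R)
            ≡⟨ cong₂ (λ d r → (k ∸ 1) * d + 2 * (k * r)) ∣D∣≡4 ∣R∣≡1 ⟩
          (k ∸ 1) * 4 + 2 * (k * 1)
            ∎
          where open ≡-Reasoning

      degree∈03 : ∀ x → degree x F ≡ 0 ⊎ degree x F ≡ 3
      degree∈03 x with degree∈034 x
      ... | inj₁ d≡0        = inj₁ d≡0
      ... | inj₂ (inj₁ d≡3) = inj₂ d≡3
      ... | inj₂ (inj₂ d≡4) = contradiction d≡4 (degree≢4 x)

      ⊥-of-length≤5 : ⊥
      ⊥-of-length≤5
        with splitting-point distinct (2≤length F≢[] uniform even₂ (≤-trans (s≤s (s≤s z≤n)) 5≤k))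
      ... | y , D≢[] , R≢[] = 3[k-1]≢2kr k (length R) 5≤k (1≤length R≢[]) ∣R∣≤2 ∑≡
        where
        D R : List (Subset n)
        D = derived y F
        R = residual y F
        ∣D∣≡3 : length D ≡ 3
        ∣D∣≡3 with degree∈03 y
        ... | inj₁ d≡0 = contradiction (subst (3 ≤_) d≡0 (3≤degree y D≢[])) λ ()
        ... | inj₂ d≡3 = d≡3
        ∣R∣≤2 : length R ≤ 2
        ∣R∣≤2 = +-cancelˡ-≤ 3 _ _
          (subst (_≤ 5) (trans (length-derived+residual y F) (cong (_+ length R) ∣D∣≡3)) ∣F∣≤5)
        pointwise : ∀ w → occurrences ⁅ w ⁆ D ≡ 2 * occurrences ⁅ w ⁆ R
        pointwise w = a≡2c _ _ (derived-evenCover y F even₂ ⁅ w ⁆ (∣⁅x⁆∣≡1 w))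
          (subst (occurrences ⁅ w ⁆ D ≤_) ∣D∣≡3 (occurrences≤length ⁅ w ⁆ D))
          (≤-trans (occurrences≤length ⁅ w ⁆ R) ∣R∣≤2)
          (degree-derived+residual {P = λ d → d ≡ 0 ⊎ d ≡ 3} y w F degree∈03)
        ∑≡ : (k ∸ 1) * 3 ≡ 2 * (k * length R)
        ∑≡ = begin
          (k ∸ 1) * 3                          ≡⟨ cong ((k ∸ 1) *_) ∣D∣≡3 ⟨
          (k ∸ 1) * length D                   ≡⟨ ∑-occurrences-⁅⁆ (derived-uniform y uniform) ⟨
          ∑[ w < n ] occurrences ⁅ w ⁆ D       ≡⟨ sum-cong-≗ pointwise ⟩
          ∑[ w < n ] (2 * occurrences ⁅ w ⁆ R) ≡⟨ *-distribˡ-sum 2 (λ w → occurrences ⁅ w ⁆ R) ⟨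
          2 * ∑[ w < n ] occurrences ⁅ w ⁆ R   ≡⟨ cong (2 *_) (∑-occurrences-⁅⁆ (residual-uniform y uniform)) ⟩
          2 * (k * length R)                   ∎
          where open ≡-Reasoning

  6≤length : 6 ≤ length F
  6≤length with any? (λ z → ≡[]? (residual z F))
  ... | yes (z , R≡[]) =
    ≤-trans (n≤1+n 6) (subst (7 ≤_) (residual≡[]⇒degree≡length z F R≡[]) 7≤∣D∣)
    where
    levels : ∀ {s} → s < 2 → EvenCover (suc s) (derived z F)
    levels {0}    _ = derived-evenCover z F even₂
    levels {1}    _ = residual≡[]⇒derived-evenCover z F R≡[] even₂
    levels {2+ _} (s≤s (s≤s ()))
    7≤∣D∣ : 7 ≤ degree z F
    7≤∣D∣ = ≤-pred (2^1+t≤1+length 2 1≤k∸1 (residual≡[]⇒derived≢[] z F F≢[] R≡[])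
      (derived-family z family) levels)
  ... | no no-core =
    ≮⇒≥ λ ∣F∣<6 → ⊥-of-length≤5 (λ z R≡[] → no-core (z , R≡[])) (m<1+n⇒m≤n ∣F∣<6)

module _ {F : List (Subset (suc (suc n)))} (F≢[] : F ≢ []) (family : UniformFamily k F)
         (5≤k : 5 ≤ k) (k-odd : ¬ 2 ∣ k) (even₂ : EvenCover 2 F) (even₃ : EvenCover 3 F) where

  private
    open UniformFamily family

    1≤k∸1 : 1 ≤ k ∸ 1
    1≤k∸1 = 5≤k⇒1≤k∸1 5≤k

    module _ (avoided : ∀ z → residual z F ≢ []) (∣F∣≤13 : length F ≤ 13) where

      7≤degree : ∀ x → derived x F ≢ [] → 7 ≤ degree x F
      7≤degree x D≢[] = ≤-pred (2^1+t≤1+length 2 1≤k∸1 D≢[] (derived-family x family) levels)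
        where
        levels : ∀ {s} → s < 2 → EvenCover (suc s) (derived x F)
        levels {0}    _ = derived-evenCover x F even₂
        levels {1}    _ = derived-evenCover x F even₃
        levels {2+ _} (s≤s (s≤s ()))

      6≤length-residual : ∀ x → 6 ≤ length (residual x F)
      6≤length-residual x =
        6≤length (avoided x) (residual-family x family) 5≤k k-odd (residual-evenCover x F even₂ even₃)

      degree≡7 : ∀ x → derived x F ≢ [] → degree x F ≡ 7
      degree≡7 x D≢[] = ≤-antisym
        (+-cancelʳ-≤ 6 _ 7 (≤-trans (+-monoʳ-≤ _ (6≤length-residual x))
          (subst (_≤ 13) (length-derived+residual x F) ∣F∣≤13)))
        (7≤degree x D≢[])

      degree∈07 : ∀ x → degree x F ≡ 0 ⊎ degree x F ≡ 7
      degree∈07 x with ≡[]? (derived x F)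
      ... | yes D≡[] = inj₁ (cong length D≡[])
      ... | no  D≢[] = inj₂ (degree≡7 x D≢[])

      split-7+6 : ∃ λ y → degree y F ≡ 7 × length (residual y F) ≡ 6
      split-7+6
        with splitting-point distinct (2≤length F≢[] uniform even₃ (≤-trans (s≤s (s≤s (s≤s z≤n))) 5≤k))
      ... | y , D≢[] , _ = y , ∣D∣≡7 , ≤-antisym ∣R∣≤6 (6≤length-residual y)
        where
        ∣D∣≡7 : degree y F ≡ 7
        ∣D∣≡7 = degree≡7 y D≢[]
        ∣R∣≤6 : length (residual y F) ≤ 6
        ∣R∣≤6 = +-cancelˡ-≤ 7 _ 6 (subst (_≤ 13)
          (trans (length-derived+residual y F) (cong (_+ length (residual y F)) ∣D∣≡7)) ∣F∣≤13)

      ⊥-of-length≤13 : ⊥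
      ⊥-of-length≤13 with split-7+6
      ... | y , ∣D∣≡7 , ∣R∣≡6 = 49[k-1]≢4[7[k-1]+6k] k 5≤k ∑≡
        where
        D R : List (Subset (suc n))
        D = derived y F
        R = residual y F
        degree∈04-D : ∀ w → occurrences ⁅ w ⁆ D ≡ 0 ⊎ occurrences ⁅ w ⁆ D ≡ 4
        degree∈04-D w = subst (λ a → a ≡ 0 ⊎ a ≡ 4) (sym (occurrences-⁅⁆ w D))
          (degree∈04 (derived-family y family) 1≤k∸1
            (derived-evenCover y F even₂) (derived-evenCover y F even₃) ∣D∣≡7 w)
        pointwise : ∀ w → 7 * occurrences ⁅ w ⁆ D ≡ 4 * (occurrences ⁅ w ⁆ D + occurrences ⁅ w ⁆ R)
        pointwise w = 7a≡4[a+c] _ _ (degree∈04-D w)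
          (subst (occurrences ⁅ w ⁆ R ≤_) ∣R∣≡6 (occurrences≤length ⁅ w ⁆ R))
          (degree-derived+residual {P = λ d → d ≡ 0 ⊎ d ≡ 7} y w F degree∈07)
        ∑D : ∑[ w < suc n ] occurrences ⁅ w ⁆ D ≡ (k ∸ 1) * length D
        ∑D = ∑-occurrences-⁅⁆ (derived-uniform y uniform)
        ∑R : ∑[ w < suc n ] occurrences ⁅ w ⁆ R ≡ k * length R
        ∑R = ∑-occurrences-⁅⁆ (residual-uniform y uniform)
        ∑≡ : 7 * ((k ∸ 1) * 7) ≡ 4 * ((k ∸ 1) * 7 + k * 6)
        ∑≡ = begin
          7 * ((k ∸ 1) * 7)
            ≡⟨ cong (λ d → 7 * ((k ∸ 1) * d)) ∣D∣≡7 ⟨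
          7 * ((k ∸ 1) * length D)
            ≡⟨ cong (7 *_) ∑D ⟨
          7 * ∑[ w < suc n ] occurrences ⁅ w ⁆ D
            ≡⟨ *-distribˡ-sum 7 (λ w → occurrences ⁅ w ⁆ D) ⟩
          ∑[ w < suc n ] (7 * occurrences ⁅ w ⁆ D)
            ≡⟨ sum-cong-≗ pointwise ⟩
          ∑[ w < suc n ] (4 * (occurrences ⁅ w ⁆ D + occurrences ⁅ w ⁆ R))
            ≡⟨ *-distribˡ-sum 4 (λ w → occurrences ⁅ w ⁆ D + occurrences ⁅ w ⁆ R) ⟨
          4 * ∑[ w < suc n ] (occurrences ⁅ w ⁆ D + occurrences ⁅ w ⁆ R)
            ≡⟨ cong (4 *_) (∑-distrib-+ (λ w → occurrences ⁅ w ⁆ D) (λ w → occurrences ⁅ w ⁆ R)) ⟩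
          4 * (∑[ w < suc n ] occurrences ⁅ w ⁆ D + ∑[ w < suc n ] occurrences ⁅ w ⁆ R)
            ≡⟨ cong (4 *_) (cong₂ _+_ ∑D ∑R) ⟩
          4 * ((k ∸ 1) * length D + k * length R)
            ≡⟨ cong₂ (λ d r → 4 * ((k ∸ 1) * d + k * r)) ∣D∣≡7 ∣R∣≡6 ⟩
          4 * ((k ∸ 1) * 7 + k * 6)
            ∎
          where open ≡-Reasoning

  14≤length : 14 ≤ length F
  14≤length with any? (λ z → ≡[]? (residual z F))
  ... | yes (z , R≡[]) =
    ≤-trans (n≤1+n 14) (subst (15 ≤_) (residual≡[]⇒degree≡length z F R≡[]) 15≤∣D∣)
    where
    levels : ∀ {s} → s < 3 → EvenCover (suc s) (derived z F)
    levels {0}          _ = derived-evenCover z F even₂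
    levels {1}          _ = derived-evenCover z F even₃
    levels {2}          _ = residual≡[]⇒derived-evenCover z F R≡[] even₃
    levels {suc (2+ _)} (s≤s (s≤s (s≤s ())))
    15≤∣D∣ : 15 ≤ degree z F
    15≤∣D∣ = ≤-pred (2^1+t≤1+length 3 1≤k∸1 (residual≡[]⇒derived≢[] z F F≢[] R≡[])
      (derived-family z family) levels)
  ... | no no-core =
    ≮⇒≥ λ ∣F∣<14 → ⊥-of-length≤13 (λ z R≡[] → no-core (z , R≡[])) (m<1+n⇒m≤n ∣F∣<14)

proposition4 : ∀ (n k : ℕ) → ¬ (2 ∣ k) → 2 ≤ k → k + 4 ≤ n →
    (D : List (Subset n)) → BinaryDesign 3 n k D → 14 ≤ length D
proposition4 n k k-odd 2≤k k+4≤n D design with m+n≤o⇒n≤o k k+4≤n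
... | s≤s (s≤s _) = 14≤length nonempty family 5≤k k-odd even₂ even
  where
  open BinaryDesign design
  family : UniformFamily k D
  family = record { distinct = distinct ; uniform = blockSize }
  5≤k : 5 ≤ k
  5≤k = odd⇒5≤k k k-odd 2≤k λ { refl → ¬evenCover-blockSize nonempty family even }
  even₂ : EvenCover 2 D
  even₂ = evenCover-lower blockSize (odd⇒odd∸2 k 2≤k k-odd) even
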